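{- Let $$W=\bigcup_{k=1}^\infty\left[\frac{(k-1)(k+2)}{2}+2^{k+1},\ \frac{(k-1)(k+2)}{2}+2^{k+1}+k\right]$$ $(=\{4,5\}\cup\{10,11,12\}\cup\{21,\dots,24\}\cup\{41,\dots,45\}\cup\cdots)$. Then: $W$ admits a minimal complement in $\mathbb{Z}$; for any asymptotic complement $C$ of $W$ and any $a,b,c\in C$ with $a<b<c$, the set $C\setminus\{b\}$ is also an asymptotic complement to $W$; and $W$ admits no minimal asymptotic complement in $\mathbb{Z}$.
   Context: $[x,y]$ denotes the set of integers $n$ with $x\le n\le y$. For nonempty $A,B\subseteq\mathbb{Z}$, $A+B=\{a+b: a\in A,b\in B\}$. Given nonempty $W,C\subseteq \mathbb{Z}$: $C$ is a complement to $W$ if $W+C=\mathbb{Z}$; a minimal complement if it is a complement but $C\setminus\{c\}$ is not for every $c\in C$. $C$ is an asymptotic complement to $W$ if $\mathbb{Z}\setminus(W+C)$ is finite; a minimal asymptotic complement if it is an asymptotic complement but $C\setminus\{c\}$ is not for every $c\in C$. -}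

module Defs where

open import Data.Nat as ℕ using (ℕ; _∸_; _^_)
open import Data.Nat.DivMod using (_/_)
open import Data.Integer using (ℤ; +_; _+_; _≤_)
open import Data.List using (List)
open import Data.List.Membership.Propositional using (_∈_)
open import Data.Product using (Σ; _×_)
open import Relation.Nullary using (¬_)
open import Relation.Binary.PropositionalEquality using (_≡_; _≢_)

ℤSet : Set₁
ℤSet = ℤ → Set

-- Left endpoint of the k-th block: (k-1)(k+2)/2 + 2^(k+1)  (for k ≥ 1 the division is exact)
start : ℕ → ℕ
start k = (((k ∸ 1) ℕ.* (k ℕ.+ 2)) / 2) ℕ.+ 2 ^ (k ℕ.+ 1)

W : ℤSet
W n = Σ ℕ λ k → (1 ℕ.≤ k) × ((+ start k ≤ n) × (n ≤ + (start k ℕ.+ k)))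

Nonempty : ℤSet → Set
Nonempty A = Σ ℤ λ a → A a

SumSet : ℤSet → ℤSet → ℤSet
SumSet A B n = Σ ℤ λ a → Σ ℤ λ b → A a × B b × (a + b ≡ n)

Remove : ℤSet → ℤ → ℤSet
Remove A x y = A y × y ≢ x

Finite : ℤSet → Set
Finite A = Σ (List ℤ) λ L → ∀ n → A n → n ∈ L

IsComplement : ℤSet → ℤSet → Set
IsComplement V C = Nonempty V × Nonempty C × (∀ n → SumSet V C n)

IsMinimalComplement : ℤSet → ℤSet → Set
IsMinimalComplement V C = IsComplement V C × (∀ c → C c → ¬ IsComplement V (Remove C c))

IsAsymptoticComplement : ℤSet → ℤSet → Set
IsAsymptoticComplement V C = Nonempty V × Nonempty C × Finite (λ n → ¬ SumSet V C n)

IsMinimalAsymptoticComplement : ℤSet → ℤSet → Set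
IsMinimalAsymptoticComplement V C =
  IsAsymptoticComplement V C × (∀ c → C c → ¬ IsAsymptoticComplement V (Remove C c))

module Submission where

-- Lemma 4.4 is proved in three parts.
-- (2) and (3) hold for every union of blocks [s k, s k + k] (k ≥ 1); W is the case s = start.
--   (2) If a < b < c lie in an asymptotic complement C, a representation n = w + b with w in
--       block k can be moved to w + b - a or to w + b - c within the same block, unless k < c - a;
--       these finitely many exceptional sums are listed explicitly.
--   (3) For a set of nonnegative integers with property (2), an asymptotic complement has
--       elements below every bound; choosing c₃ < c₂ < c₁ in C shows that c₂ is removable.
-- (1) ℕ is tiled by the consecutive tiles [A i, A (i + 1)) of length G i + 1, each covered by a
--     translate of block G i, and the negative integers by the mirrored tiles; these translates
--     form a complement of W.  It is minimal because X i = 3·2^(8i+3) ∈ tile i (and - X i) lies in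
--     no other translate of W: seen from another translate j, it falls either within 2^(G j) of
--     block G j but outside it (tile j long), or deep in the gap of W after block 8i + 3 (tile j
--     short), and neither kind of point is in W.
-- The file develops the general results (block unions, tilings) first, then the arithmetic of
-- start and the gaps of W, the tile parameters, the private points, and finally the theorem.

open import Defs

module BlockUnions where

  open import Data.Nat as ℕ using (ℕ; suc; z≤n; s≤s)
  open import Data.Integer hiding (suc)
  open import Data.Integer.Properties
  open import Data.Integer.Tactic.RingSolver using (solve-∀)
  open import Data.List using (List; []; _∷_; _++_; concat; applyUpTo)
  open import Data.List.Relation.Unary.Any using (here; there)
  open import Data.List.Membership.DecPropositional _≟_ using (_∈_; _∉_; _∈?_)
  open import Data.List.Membership.Propositional.Properties using (∈-++⁺ˡ; ∈-++⁺ʳ; ∈-concat⁺′; ∈-applyUpTo⁺)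
  open import Data.Product using (Σ; _×_; _,_)
  open import Data.Sum using (_⊎_; inj₁; inj₂)
  open import Data.Empty using (⊥-elim)
  open import Relation.Nullary using (¬_; yes; no)
  open import Relation.Binary.PropositionalEquality

  Blocks : (ℕ → ℕ) → ℤSet
  Blocks s n = Σ ℕ λ k → (1 ℕ.≤ k) × ((+ s k ≤ n) × (n ≤ + (s k ℕ.+ k)))

  move-< : ∀ {x y z u} → x + y < z + u → x - u < z - y
  move-< {x} {y} {z} {u} lt = subst₂ _<_ (left x y u) (right z u y) (+-monoˡ-< (- y - u) lt)
    where
    left : ∀ p q r → p + q + (- q - r) ≡ p - r
    left = solve-∀
    right : ∀ p q r → p + q + (- r - q) ≡ p - r
    right = solve-∀

  slide : ∀ {lo hi w} a b c → lo ≤ w → w ≤ hi → a ≤ b → b ≤ c →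
          (lo ≤ w + b - a × w + b - a ≤ hi) ⊎ (lo ≤ w + b - c × w + b - c ≤ hi) ⊎ hi - lo < c - a
  slide {lo} {hi} {w} a b c lo≤w w≤hi a≤b b≤c with w + b - a ≤? hi | lo ≤? w + b - c
  ... | yes ≤hi | _ = inj₁ (≤-trans lo≤w shift , ≤hi)
    where
    shift : w ≤ w + b - a
    shift = subst (_≤ w + b - a) (cancel w a) (+-monoˡ-≤ (- a) (+-monoʳ-≤ w a≤b))
      where
      cancel : ∀ w a → w + a - a ≡ w
      cancel = solve-∀
  ... | no _ | yes lo≤ = inj₂ (inj₁ (lo≤ , ≤-trans shift w≤hi))
    where
    shift : w + b - c ≤ w
    shift = subst (w + b - c ≤_) (cancel w c) (+-monoˡ-≤ (- c) (+-monoʳ-≤ w b≤c))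
      where
      cancel : ∀ w c → w + c - c ≡ w
      cancel = solve-∀
  ... | no ≰hi | no lo≰ = inj₂ (inj₂ (subst (hi - lo <_) (diff w b a c)
                            (move-< {hi} {w + b - c} {w + b - a} {lo} (+-mono-< (≰⇒> ≰hi) (≰⇒> lo≰)))))
    where
    diff : ∀ w b a c → w + b - a - (w + b - c) ≡ c - a
    diff = solve-∀

  -- The points b + j with 0 ≤ j ≤ s k + k for some k < K; it contains b + (block k) for all k < K.
  shortTranslates : (ℕ → ℕ) → ℤ → ℕ → List ℤ
  shortTranslates s b K = concat (applyUpTo (λ k → applyUpTo (λ j → b + + j) (suc (s k ℕ.+ k))) K)

  shortTranslates-∈ : ∀ s b {K k j} → k ℕ.< K → j ℕ.≤ s k ℕ.+ k → b + + j ∈ shortTranslates s b K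
  shortTranslates-∈ s b k<K j≤ = ∈-concat⁺′ (∈-applyUpTo⁺ (λ j → b + + j) (s≤s j≤)) (∈-applyUpTo⁺ _ k<K)

  -- If a < b < c all lie in an asymptotic complement C of a union of blocks, then b may be removed:
  -- a representation w + b with w in block k can be slid to w + b - a or w + b - c, except when
  -- k < c - a, and those exceptional sums lie in a finite list.
  removeMiddle : ∀ s (C : ℤSet) → IsAsymptoticComplement (Blocks s) C →
    ∀ a b c → C a → C b → C c → a < b → b < c → IsAsymptoticComplement (Blocks s) (Remove C b)
  removeMiddle s C (nonemptyBlocks , _ , (L , L-complete)) a b c Ca _ Cc a<b b<c =
    nonemptyBlocks , (a , Ca , a≢b) , (L ++ exceptions , complete)
    where
    a≢b : a ≢ b
    a≢b a≡b = <-irrefl a≡b a<b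
    c≢b : c ≢ b
    c≢b c≡b = <-irrefl (sym c≡b) b<c
    K : ℕ
    K = ∣ c - a ∣
    exceptions : List ℤ
    exceptions = shortTranslates s b K

    index<K : ∀ {k} → + (s k ℕ.+ k) - + s k < c - a → k ℕ.< K
    index<K {k} short = drop‿+<+ (subst (+ k <_) (sym (0≤i⇒+∣i∣≡i (<⇒≤ (≤-<-trans (+≤+ z≤n) k<c-a)))) k<c-a)
      where
      length : ∀ x y → x + y - x ≡ y
      length = solve-∀
      k<c-a : + k < c - a
      k<c-a = subst (_< c - a) (trans (cong (_- + s k) (pos-+ (s k) k)) (length (+ s k) (+ k))) short

    -- A non-sum of Blocks s + (C \ {b}) not among the exceptions is a non-sum of Blocks s + C.
    -- (Membership in the list is decidable, which makes this argument constructive.)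
    complete : ∀ n → ¬ SumSet (Blocks s) (Remove C b) n → n ∈ L ++ exceptions
    complete n missed with n ∈? L ++ exceptions
    ... | yes n∈ = n∈
    ... | no n∉ = ⊥-elim (n∉ (∈-++⁺ˡ (L-complete n notSum)))
      where
      resum : ∀ w x → w + b ≡ n → w + b - x + x ≡ n
      resum w x w+b≡n = trans (cancel (w + b) x) w+b≡n
        where
        cancel : ∀ y x → y - x + x ≡ y
        cancel = solve-∀
      notSum : ¬ SumSet (Blocks s) C n
      notSum (w , c′ , Bw , Cc′ , w+c′≡n) with c′ ≟ b
      ... | no c′≢b = missed (w , c′ , Bw , (Cc′ , c′≢b) , w+c′≡n)
      notSum (w , _ , (k , 1≤k , lo≤w , w≤hi) , _ , w+b≡n) | yes refl
        with slide a b c lo≤w w≤hi (<⇒≤ a<b) (<⇒≤ b<c)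
      ... | inj₁ (lo≤ , ≤hi) = missed (w + b - a , a , (k , 1≤k , lo≤ , ≤hi) , (Ca , a≢b) , resum w a w+b≡n)
      ... | inj₂ (inj₁ (lo≤ , ≤hi)) = missed (w + b - c , c , (k , 1≤k , lo≤ , ≤hi) , (Cc , c≢b) , resum w c w+b≡n)
      ... | inj₂ (inj₂ short) with w | lo≤w | w≤hi
      ...   | + m | _ | +≤+ m≤hi = n∉ (∈-++⁺ʳ L (subst (_∈ exceptions) (trans (+-comm b (+ m)) w+b≡n)
                                          (shortTranslates-∈ s b (index<K short) m≤hi)))

  RemovalProperty : ℤSet → Set₁
  RemovalProperty V = ∀ (C : ℤSet) → IsAsymptoticComplement V C →
    ∀ a b c → C a → C b → C c → a < b → b < c → IsAsymptoticComplement V (Remove C b)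

  missBelow : (L : List ℤ) (t : ℤ) → Σ ℤ λ n → n < t × n ∉ L
  missBelow [] t = pred t , suc[i]≤j⇒i<j (≤-reflexive (suc-pred t)) , λ ()
  missBelow (x ∷ L) t with t ≤? x
  ... | yes t≤x with missBelow L t
  ...   | n , n<t , n∉L = n , n<t , λ { (here n≡x) → <-irrefl n≡x (<-≤-trans n<t t≤x) ; (there n∈L) → n∉L n∈L }
  missBelow (x ∷ L) t | no t≰x with missBelow L x
  ...   | n , n<x , n∉L = n , <-trans n<x (≰⇒> t≰x) , λ { (here n≡x) → <-irrefl n≡x n<x ; (there n∈L) → n∉L n∈L }

  -- If V consists of nonnegative integers, an asymptotic complement of V has elements below
  -- any bound t: some n < t missing from the exception list is a sum v + c with c ≤ n.
  elementBelow : ∀ {V C : ℤSet} → (∀ v → V v → 0ℤ ≤ v) → IsAsymptoticComplement V C →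
                 ∀ t → ¬ ¬ (Σ ℤ λ c → C c × c < t)
  elementBelow {V} {C} V≥0 (_ , _ , (L , L-complete)) t noneBelow with missBelow L t
  ... | n , n<t , n∉L = n∉L (L-complete n notSum)
    where
    notSum : ¬ SumSet V C n
    notSum (v , c , Vv , Cc , v+c≡n) = noneBelow (c , Cc , ≤-<-trans c≤n n<t)
      where
      c≤n : c ≤ n
      c≤n = subst₂ _≤_ (+-identityˡ c) v+c≡n (+-monoˡ-≤ c (V≥0 v Vv))

  -- For a set of nonnegative integers with the removal property there is no minimal asymptotic
  -- complement: from c₁ ∈ C pick c₂ < c₁ and c₃ < c₂ in C; then c₂ is removable.
  noMinimalAsymptoticComplement : ∀ V → (∀ v → V v → 0ℤ ≤ v) → RemovalProperty V →
                                  ¬ (Σ ℤSet λ C → IsMinimalAsymptoticComplement V C)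
  noMinimalAsymptoticComplement V V≥0 removal (C , asymptotic@(_ , (c₁ , Cc₁) , _) , minimal) =
    elementBelow V≥0 asymptotic c₁ λ { (c₂ , Cc₂ , c₂<c₁) →
    elementBelow V≥0 asymptotic c₂ λ { (c₃ , Cc₃ , c₃<c₂) →
    minimal c₂ Cc₂ (removal C asymptotic c₃ c₂ c₁ Cc₃ Cc₂ Cc₁ c₃<c₂ c₂<c₁) } }

  Blocks≥0 : ∀ s v → Blocks s v → 0ℤ ≤ v
  Blocks≥0 s v (_ , _ , s≤v , _) = ≤-trans (+≤+ z≤n) s≤v

module Tilings where

  open BlockUnions using (Blocks)

  open import Data.Nat as ℕ using (ℕ; zero; suc; z≤n; s≤s)
  import Data.Nat.Properties as ℕP
  open import Data.Integer hiding (suc)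
  open import Data.Integer.Properties
  open import Data.Integer.Tactic.RingSolver using (solve-∀)
  open import Data.Product using (Σ; _×_; _,_)
  open import Data.Sum using (_⊎_; inj₁; inj₂)
  open import Relation.Nullary using (yes; no)
  open import Relation.Binary.PropositionalEquality

  -- Tiling ℤ by translates of blocks: tile i is [a i, a (i + 1)) of length g i + 1, covered by
  -- block g i of Blocks s, and its mirror image [- a (i + 1), - a i) is covered the same way.
  module Tiling (s g a : ℕ → ℕ) (a-zero : a 0 ≡ 0) (a-suc : ∀ i → a (suc i) ≡ a i ℕ.+ suc (g i))
                (g≥1 : ∀ i → 1 ℕ.≤ g i) where

    a-step : ∀ i → a i ℕ.< a (suc i)
    a-step i = subst (a i ℕ.<_) (sym (a-suc i)) (ℕP.m<m+n (a i) (s≤s z≤n))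

    locate : ∀ m → Σ ℕ λ i → a i ℕ.≤ m × m ℕ.< a (suc i)
    locate zero = 0 , ℕP.≤-reflexive a-zero , subst (ℕ._< a 1) a-zero (a-step 0)
    locate (suc m) with locate m
    ... | i , a≤m , m<a′ with suc m ℕ.<? a (suc i)
    ...   | yes m+1<a′ = i , ℕP.≤-trans a≤m (ℕP.n≤1+n m) , m+1<a′
    ...   | no m+1≮a′ = suc i , ℕP.≤-reflexive (sym m+1≡a′) , subst (ℕ._< a (suc (suc i))) (sym m+1≡a′) (a-step (suc i))
      where
      m+1≡a′ : suc m ≡ a (suc i)
      m+1≡a′ = ℕP.≤-antisym m<a′ (ℕP.≮⇒≥ m+1≮a′)

    -- The translates carrying block g i onto tile i and onto its mirror image.
    shift⁺ : ℕ → ℤ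
    shift⁺ i = + a i - + s (g i)

    shift⁻ : ℕ → ℤ
    shift⁻ i = - + (a (suc i) ℕ.+ s (g i))

    Shifts : ℤSet
    Shifts x = Σ ℕ λ i → (x ≡ shift⁺ i) ⊎ (x ≡ shift⁻ i)

    inBlock : ∀ i d → d ℕ.≤ g i → Blocks s (+ (s (g i) ℕ.+ d))
    inBlock i d d≤g = g i , g≥1 i , +≤+ (ℕP.m≤m+n (s (g i)) d) , +≤+ (ℕP.+-monoʳ-≤ (s (g i)) d≤g)

    tileLength : ∀ i → a (suc i) ℕ.∸ suc (a i) ≡ g i
    tileLength i = trans (cong (ℕ._∸ suc (a i)) (trans (a-suc i) (ℕP.+-suc (a i) (g i)))) (ℕP.m+n∸m≡n (suc (a i)) (g i))

    covers : ∀ n → SumSet (Blocks s) Shifts n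
    covers (+ m) with locate m
    ... | i , a≤m , m<a′ = + (s (g i) ℕ.+ d) , shift⁺ i , inBlock i d d≤g , (i , inj₁ refl) , sum
      where
      d = m ℕ.∸ a i
      d≤g : d ℕ.≤ g i
      d≤g = subst (d ℕ.≤_) (tileLength i) (ℕP.∸-monoˡ-≤ (suc (a i)) m<a′)
      sum : + (s (g i) ℕ.+ d) + shift⁺ i ≡ + m
      sum = begin
        + (s (g i) ℕ.+ d) + (+ a i - + s (g i))   ≡⟨ cong (_+ (+ a i - + s (g i))) (pos-+ (s (g i)) d) ⟩
        + s (g i) + + d + (+ a i - + s (g i))     ≡⟨ cancel (+ s (g i)) (+ d) (+ a i) ⟩
        + a i + + d                               ≡⟨ pos-+ (a i) d ⟨
        + (a i ℕ.+ d)                             ≡⟨ cong +_ (ℕP.m+[n∸m]≡n a≤m) ⟩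
        + m                                       ∎
        where
        open ≡-Reasoning
        cancel : ∀ x y z → x + y + (z - x) ≡ z + y
        cancel = solve-∀
    covers -[1+ m ] with locate m
    ... | i , a≤m , m<a′ = + (s (g i) ℕ.+ d) , shift⁻ i , inBlock i d d≤g , (i , inj₂ refl) , sum
      where
      d = a (suc i) ℕ.∸ suc m
      d≤g : d ℕ.≤ g i
      d≤g = subst (d ℕ.≤_) (tileLength i) (ℕP.∸-monoʳ-≤ (a (suc i)) (s≤s a≤m))
      sum : + (s (g i) ℕ.+ d) + shift⁻ i ≡ -[1+ m ]
      sum = begin
        + (s (g i) ℕ.+ d) + - + (a (suc i) ℕ.+ s (g i))
          ≡⟨ cong₂ (λ x y → x + - y) (pos-+ (s (g i)) d) boundary ⟩
        + s (g i) + + d + - (+ suc m + + d + + s (g i))   ≡⟨ cancel (+ s (g i)) (+ d) (+ suc m) ⟩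
        - + suc m                                          ∎
        where
        open ≡-Reasoning
        cancel : ∀ x y z → x + y + - (z + y + x) ≡ - z
        cancel = solve-∀
        boundary : + (a (suc i) ℕ.+ s (g i)) ≡ + suc m + + d + + s (g i)
        boundary = begin
          + (a (suc i) ℕ.+ s (g i))     ≡⟨ cong (λ x → + (x ℕ.+ s (g i))) (ℕP.m+[n∸m]≡n m<a′) ⟨
          + (suc m ℕ.+ d ℕ.+ s (g i))   ≡⟨ pos-+ (suc m ℕ.+ d) (s (g i)) ⟩
          + (suc m ℕ.+ d) + + s (g i)   ≡⟨ cong (_+ + s (g i)) (pos-+ (suc m) d) ⟩
          + suc m + + d + + s (g i)     ∎

module GapsOfW where

  open import Data.Nat
  open import Data.Nat.Properties
  open import Data.Nat.DivMod using (_/_; m*n/n≡m)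
  open import Data.Nat.Tactic.RingSolver using (solve-∀)
  import Data.Integer as ℤ
  open import Data.Product using (_,_)
  open import Data.Sum using (inj₁; inj₂)
  open import Data.Unit using (tt)
  open import Relation.Nullary using (¬_)
  open import Relation.Binary.PropositionalEquality

  pow-suc : ∀ a → 2 ^ suc a ≡ 2 ^ a + 2 ^ a
  pow-suc a = cong (2 ^ a +_) (+-identityʳ (2 ^ a))

  pow-mono : ∀ {a b} → a ≤ b → 2 ^ a ≤ 2 ^ b
  pow-mono = ^-monoʳ-≤ 2

  pow-pos : ∀ a → 1 ≤ 2 ^ a
  pow-pos = m^n>0 2

  n<2^n : ∀ n → n < 2 ^ n
  n<2^n zero = s≤s z≤n
  n<2^n (suc n) = begin-strict
    suc n        ≡⟨ +-comm 1 n ⟩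
    n + 1        <⟨ +-mono-<-≤ (n<2^n n) (pow-pos n) ⟩
    2 ^ n + 2 ^ n ≡⟨ pow-suc n ⟨
    2 ^ suc n    ∎
    where open ≤-Reasoning hiding (start)

  linear≤pow : ∀ m → 5 ≤ m → 4 * suc m ≤ 2 ^ m
  linear≤pow m 5≤m = subst (λ k → 4 * suc k ≤ 2 ^ k) (m+[n∸m]≡n 5≤m) (shifted (m ∸ 5))
    where
    shifted : ∀ n → 4 * suc (5 + n) ≤ 2 ^ (5 + n)
    shifted zero = ≤ᵇ⇒≤ 24 32 tt
    shifted (suc n) = begin
      4 * suc (6 + n)             ≡⟨ step n ⟩
      4 * suc (5 + n) + 4          ≤⟨ +-mono-≤ (shifted n) (pow-mono {2} {5 + n} (s≤s (s≤s z≤n))) ⟩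
      2 ^ (5 + n) + 2 ^ (5 + n)    ≡⟨ pow-suc (5 + n) ⟨
      2 ^ (6 + n)                  ∎
      where
      open ≤-Reasoning hiding (start)
      step : ∀ n → 4 * suc (6 + n) ≡ 4 * suc (5 + n) + 4
      step = solve-∀

  monotone : ∀ (f : ℕ → ℕ) → (∀ n → f n ≤ f (suc n)) → ∀ {k m} → k ≤ m → f k ≤ f m
  monotone f step {m = zero} z≤n = ≤-refl
  monotone f step {k} {suc m} k≤1+m with m≤n⇒m<n∨m≡n k≤1+m
  ... | inj₁ (s≤s k≤m) = ≤-trans (monotone f step k≤m) (step m)
  ... | inj₂ refl = ≤-refl

  -- The triangular part of start: tri k = (k - 1)(k + 2) / 2.
  tri : ℕ → ℕ
  tri zero = 0
  tri (suc zero) = 0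
  tri (suc (suc k)) = tri (suc k) + suc (suc k)

  tri-double : ∀ k → tri k * 2 ≡ (k ∸ 1) * (k + 2)
  tri-double zero = refl
  tri-double (suc zero) = refl
  tri-double (suc (suc k)) = begin
    (tri (suc k) + suc (suc k)) * 2     ≡⟨ *-distribʳ-+ 2 (tri (suc k)) (suc (suc k)) ⟩
    tri (suc k) * 2 + suc (suc k) * 2   ≡⟨ cong (_+ suc (suc k) * 2) (tri-double (suc k)) ⟩
    k * (suc k + 2) + suc (suc k) * 2   ≡⟨ expand k ⟩
    suc k * (suc (suc k) + 2)           ∎
    where
    open ≡-Reasoning
    expand : ∀ k → k * (suc k + 2) + suc (suc k) * 2 ≡ suc k * (suc (suc k) + 2)
    expand = solve-∀

  start≡ : ∀ k → start k ≡ tri k + 2 ^ suc k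
  start≡ k = cong₂ _+_ (trans (cong (_/ 2) (sym (tri-double k))) (m*n/n≡m (tri k) 2))
                       (cong (2 ^_) (+-comm k 1))

  -- Consecutive blocks: block m ends at start m + m and is followed by a gap of length 2^(m+1).
  start-suc : ∀ m → 1 ≤ m → start (suc m) ≡ start m + suc m + 2 ^ suc m
  start-suc m@(suc _) _ = begin
    start (suc m)                               ≡⟨ start≡ (suc m) ⟩
    tri m + suc m + 2 ^ suc (suc m)             ≡⟨ cong (tri m + suc m +_) (pow-suc (suc m)) ⟩
    tri m + suc m + (2 ^ suc m + 2 ^ suc m)     ≡⟨ regroup (tri m) (suc m) (2 ^ suc m) ⟩
    tri m + 2 ^ suc m + suc m + 2 ^ suc m       ≡⟨ cong (λ x → x + suc m + 2 ^ suc m) (start≡ m) ⟨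
    start m + suc m + 2 ^ suc m                 ∎
    where
    open ≡-Reasoning
    regroup : ∀ t m p → t + m + (p + p) ≡ t + p + m + p
    regroup = solve-∀

  start-mono : ∀ {k m} → k ≤ m → start k ≤ start m
  start-mono {k} {m} k≤m = subst₂ _≤_ (sym (start≡ k)) (sym (start≡ m))
    (+-mono-≤ (monotone tri tri-step k≤m) (pow-mono (s≤s k≤m)))
    where
    tri-step : ∀ n → tri n ≤ tri (suc n)
    tri-step zero = z≤n
    tri-step (suc n) = m≤m+n (tri (suc n)) (suc (suc n))

  tri≤pow : ∀ m → 5 ≤ m → tri m + 2 * suc m ≤ 2 ^ m
  tri≤pow m 5≤m = subst (λ k → tri k + 2 * suc k ≤ 2 ^ k) (m+[n∸m]≡n 5≤m) (shifted (m ∸ 5))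
    where
    shifted : ∀ n → tri (5 + n) + 2 * suc (5 + n) ≤ 2 ^ (5 + n)
    shifted zero = ≤ᵇ⇒≤ 26 32 tt
    shifted (suc n) = begin
      tri (6 + n) + 2 * suc (6 + n)                     ≡⟨ step (tri (5 + n)) n ⟩
      (tri (5 + n) + 2 * suc (5 + n)) + (8 + n)         ≤⟨ +-mono-≤ (shifted n) (≤-trans small (linear≤pow (5 + n) (m≤m+n 5 n))) ⟩
      2 ^ (5 + n) + 2 ^ (5 + n)                          ≡⟨ pow-suc (5 + n) ⟨
      2 ^ (6 + n)                                        ∎
      where
      open ≤-Reasoning hiding (start)
      step : ∀ t n → t + (6 + n) + 2 * suc (6 + n) ≡ (t + 2 * suc (5 + n)) + (8 + n)
      step = solve-∀
      expand : ∀ n → 24 + 4 * n ≡ 4 * suc (5 + n)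
      expand = solve-∀
      small : 8 + n ≤ 4 * suc (5 + n)
      small = subst (8 + n ≤_) (expand n) (+-mono-≤ (≤ᵇ⇒≤ 8 24 tt) (m≤n*m n 4))

  betweenBlocks : ∀ m n → start m + m < n → n < start (suc m) → ¬ W (ℤ.+ n)
  betweenBlocks m n afterBlock beforeNext (k , _ , ℤ.+≤+ start≤n , ℤ.+≤+ n≤end) with ≤-total k m
  ... | inj₁ k≤m = <-irrefl refl (≤-<-trans (≤-trans n≤end (+-mono-≤ (start-mono k≤m) k≤m)) afterBlock)
  ... | inj₂ m≤k with m≤n⇒m<n∨m≡n m≤k
  ...   | inj₁ m<k = <-irrefl refl (<-≤-trans beforeNext (≤-trans (start-mono m<k) start≤n))
  ...   | inj₂ refl = <-irrefl refl (≤-<-trans n≤end afterBlock)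

  rightOfBlock : ∀ g → 1 ≤ g → ∀ n e f → n + e ≡ start g + f → e + g < f → f ≤ e + 2 ^ g → ¬ W (ℤ.+ n)
  rightOfBlock g 1≤g n e f eq right near = betweenBlocks g n afterBlock beforeNext
    where
    open ≤-Reasoning hiding (start)
    afterBlock : start g + g < n
    afterBlock = +-cancelʳ-< e (start g + g) n (begin-strict
      start g + g + e     ≡⟨ swap (start g) g e ⟩
      start g + (e + g)   <⟨ +-monoʳ-< (start g) right ⟩
      start g + f         ≡⟨ eq ⟨
      n + e               ∎)
      where
      swap : ∀ s g e → s + g + e ≡ s + (e + g)
      swap = solve-∀
    beforeNext : n < start (suc g)
    beforeNext = +-cancelʳ-< e n (start (suc g)) (begin-strict
      n + e                           ≡⟨ eq ⟩
      start g + f                     ≤⟨ +-monoʳ-≤ (start g) near ⟩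
      start g + (e + 2 ^ g)           <⟨ +-monoʳ-< (start g) (+-monoʳ-< e (m<n+m (2 ^ g) z<s)) ⟩
      start g + (e + (suc g + 2 ^ g)) ≤⟨ +-monoʳ-≤ (start g) (+-monoʳ-≤ e (+-monoʳ-≤ (suc g) (pow-mono (n≤1+n g)))) ⟩
      start g + (e + (suc g + 2 ^ suc g)) ≡⟨ regroup (start g) e (suc g) (2 ^ suc g) ⟩
      start g + suc g + 2 ^ suc g + e ≡⟨ cong (_+ e) (start-suc g 1≤g) ⟨
      start (suc g) + e               ∎)
      where
      regroup : ∀ s e g p → s + (e + (g + p)) ≡ s + g + p + e
      regroup = solve-∀

  leftOfBlock : ∀ g → 2 ≤ g → ∀ n e f → n + e ≡ start g + f → f < e → e ≤ f + 2 ^ g → ¬ W (ℤ.+ n)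
  leftOfBlock g@(suc h) (s≤s 1≤h) n e f eq left near = betweenBlocks h n afterPrevious beforeBlock
    where
    open ≤-Reasoning hiding (start)
    beforeBlock : n < start g
    beforeBlock = +-cancelʳ-< e n (start g) (begin-strict
      n + e        ≡⟨ eq ⟩
      start g + f  <⟨ +-monoʳ-< (start g) left ⟩
      start g + e  ∎)
    afterPrevious : start h + h < n
    afterPrevious = +-cancelʳ-≤ (f + 2 ^ g) (suc (start h + h)) n (begin
      suc (start h + h) + (f + 2 ^ g)   ≡⟨ regroup (start h) h f (2 ^ g) ⟩
      start h + suc h + 2 ^ g + f       ≡⟨ cong (_+ f) (start-suc h 1≤h) ⟨
      start g + f                       ≡⟨ eq ⟨
      n + e                             ≤⟨ +-monoʳ-≤ n near ⟩
      n + (f + 2 ^ g)                   ∎)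
      where
      regroup : ∀ s h f p → suc (s + h) + (f + p) ≡ s + suc h + p + f
      regroup = solve-∀

  endBlock<3·2^c : ∀ c → 5 ≤ c → start c + c < 3 * 2 ^ c
  endBlock<3·2^c c 5≤c = begin-strict
    start c + c                   ≡⟨ cong (_+ c) (start≡ c) ⟩
    tri c + 2 ^ suc c + c         ≡⟨ regroup (tri c) (2 ^ suc c) c ⟩
    (tri c + c) + 2 ^ suc c       <⟨ +-monoˡ-< (2 ^ suc c) (<-≤-trans (+-monoʳ-< (tri c) (m≤n*m (suc c) 2)) (tri≤pow c 5≤c)) ⟩
    2 ^ c + 2 ^ suc c             ≡⟨ triple (2 ^ c) ⟩
    3 * 2 ^ c                     ∎
    where
    open ≤-Reasoning hiding (start)
    regroup : ∀ t p c → t + p + c ≡ (t + c) + p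
    regroup = solve-∀
    triple : ∀ p → p + 2 * p ≡ 3 * p
    triple = solve-∀

  4·2^c≤startNext : ∀ c → 4 * 2 ^ c ≤ start (suc c)
  4·2^c≤startNext c = subst₂ _≤_ (quadruple (2 ^ c)) (sym (start≡ (suc c))) (m≤n+m (2 ^ suc (suc c)) (tri (suc c)))
    where
    quadruple : ∀ p → 2 * (2 * p) ≡ 4 * p
    quadruple = solve-∀

  nearMiddleOfGap : ∀ c → 5 ≤ c → ∀ n e f → n + e ≡ 3 * 2 ^ c + f → e ≤ f → f < 2 ^ c → ¬ W (ℤ.+ n)
  nearMiddleOfGap c 5≤c n e f eq e≤f f<2^c = betweenBlocks c n afterBlock beforeNext
    where
    open ≤-Reasoning hiding (start)
    afterBlock : start c + c < n
    afterBlock = <-≤-trans (endBlock<3·2^c c 5≤c) (+-cancelʳ-≤ e (3 * 2 ^ c) n (begin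
      3 * 2 ^ c + e  ≤⟨ +-monoʳ-≤ (3 * 2 ^ c) e≤f ⟩
      3 * 2 ^ c + f  ≡⟨ eq ⟨
      n + e          ∎))
    beforeNext : n < start (suc c)
    beforeNext = begin-strict
      n                     ≤⟨ m≤m+n n e ⟩
      n + e                 ≡⟨ eq ⟩
      3 * 2 ^ c + f         <⟨ +-monoʳ-< (3 * 2 ^ c) f<2^c ⟩
      3 * 2 ^ c + 2 ^ c     ≡⟨ +-comm (3 * 2 ^ c) (2 ^ c) ⟩
      4 * 2 ^ c             ≤⟨ 4·2^c≤startNext c ⟩
      start (suc c)         ∎

module TileParameters where

  open GapsOfW

  open import Data.Nat
  open import Data.Nat.Properties
  open import Data.Nat.Tactic.RingSolver using (solve-∀)
  open import Data.Unit using (tt)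
  open import Relation.Binary.PropositionalEquality

  -- Tile i is [A i, A (i + 1)); it has length L i = 8 · M i and is covered by block G i = L i - 1.
  A : ℕ → ℕ
  A zero = 0
  A (suc i) = 2 ^ (8 * i + 12)

  M : ℕ → ℕ
  M zero = 512
  M (suc i) = 255 * 2 ^ (8 * i + 9)

  L : ℕ → ℕ
  L i = 8 * M i

  G : ℕ → ℕ
  G i = pred (L i)

  S : ℕ → ℕ
  S i = start (G i)

  -- The private point of tile i: 3 · 2^c for c = 8i + 3, in the middle of the gap after block c.
  X : ℕ → ℕ
  X i = 3 * 2 ^ (8 * i + 3)

  M≥512 : ∀ i → 512 ≤ M i
  M≥512 zero = ≤-refl
  M≥512 (suc i) = ≤-trans (pow-mono {9} {8 * i + 9} (m≤n+m 9 (8 * i))) (m≤n*m (2 ^ (8 * i + 9)) 255)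

  L≥4096 : ∀ i → 4096 ≤ L i
  L≥4096 i = *-monoʳ-≤ 8 (M≥512 i)

  L≡suc-G : ∀ i → L i ≡ suc (G i)
  L≡suc-G i = sym (suc-pred (L i) {{>-nonZero (≤-trans (s≤s z≤n) (L≥4096 i))}})

  G≥4095 : ∀ i → 4095 ≤ G i
  G≥4095 i = s≤s⁻¹ (subst (4096 ≤_) (L≡suc-G i) (L≥4096 i))

  A-suc : ∀ i → A (suc i) ≡ A i + suc (G i)
  A-suc i = trans (consecutive i) (cong (A i +_) (L≡suc-G i))
    where
    consecutive : ∀ i → A (suc i) ≡ A i + L i
    consecutive zero = refl
    consecutive (suc k) = begin
      2 ^ (8 * suc k + 12)         ≡⟨ cong (2 ^_) (exponent k) ⟩
      2 ^ (11 + (8 * k + 9))       ≡⟨ ^-distribˡ-+-* 2 11 (8 * k + 9) ⟩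
      2048 * q                     ≡⟨ factor q ⟩
      8 * q + 8 * (255 * q)        ≡⟨ cong (_+ 8 * (255 * q)) (^-distribˡ-+-* 2 3 (8 * k + 9)) ⟨
      2 ^ (3 + (8 * k + 9)) + 8 * (255 * q) ≡⟨ cong (λ e → 2 ^ e + 8 * (255 * q)) (exponent′ k) ⟩
      2 ^ (8 * k + 12) + 8 * (255 * q) ∎
      where
      open ≡-Reasoning
      q = 2 ^ (8 * k + 9)
      exponent : ∀ k → 8 * suc k + 12 ≡ 11 + (8 * k + 9)
      exponent = solve-∀
      factor : ∀ q → 2048 * q ≡ 8 * q + 8 * (255 * q)
      factor = solve-∀
      exponent′ : ∀ k → 3 + (8 * k + 9) ≡ 8 * k + 12
      exponent′ = solve-∀

  A≤L : ∀ i → A i ≤ L i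
  A≤L zero = z≤n
  A≤L (suc k) = begin
    2 ^ (8 * k + 12)          ≡⟨ cong (2 ^_) (exponent k) ⟨
    2 ^ (3 + (8 * k + 9))     ≡⟨ ^-distribˡ-+-* 2 3 (8 * k + 9) ⟩
    8 * q                     ≤⟨ *-monoʳ-≤ 8 (m≤n*m q 255) ⟩
    8 * (255 * q)             ∎
    where
    open ≤-Reasoning hiding (start)
    q = 2 ^ (8 * k + 9)
    exponent : ∀ k → 3 + (8 * k + 9) ≡ 8 * k + 12
    exponent = solve-∀

  A-mono : ∀ {k m} → k ≤ m → A k ≤ A m
  A-mono = monotone A (λ n → subst (A n ≤_) (sym (A-suc n)) (m≤m+n (A n) (suc (G n))))

  A-suc≤2L : ∀ j → A (suc j) ≤ 2 * L j
  A-suc≤2L j = begin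
    A (suc j)          ≡⟨ A-suc j ⟩
    A j + suc (G j)    ≡⟨ cong (A j +_) (L≡suc-G j) ⟨
    A j + L j          ≤⟨ +-monoˡ-≤ (L j) (A≤L j) ⟩
    L j + L j          ≡⟨ cong (L j +_) (+-identityʳ (L j)) ⟨
    2 * L j            ∎
    where open ≤-Reasoning hiding (start)

  A<X : ∀ i → A i < X i
  A<X zero = s≤s z≤n
  A<X (suc k) = begin-strict
    2 ^ (8 * k + 12)            ≡⟨ cong (2 ^_) (exponent k) ⟩
    2 ^ (1 + (8 * k + 11))      ≡⟨ ^-distribˡ-+-* 2 1 (8 * k + 11) ⟩
    2 * q                       <⟨ *-monoˡ-< q {2} {3} ≤-refl ⟩
    3 * q                       ≡⟨ cong (λ c → 3 * 2 ^ c) (exponent′ k) ⟩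
    3 * 2 ^ (8 * suc k + 3)     ∎
    where
    open ≤-Reasoning hiding (start)
    q = 2 ^ (8 * k + 11)
    instance _ = >-nonZero (pow-pos (8 * k + 11))
    exponent : ∀ k → 8 * k + 12 ≡ 1 + (8 * k + 11)
    exponent = solve-∀
    exponent′ : ∀ k → 8 * k + 11 ≡ 8 * suc k + 3
    exponent′ = solve-∀

  X<A-suc : ∀ i → X i < A (suc i)
  X<A-suc i = begin-strict
    3 * q                    <⟨ *-monoˡ-< q {3} {16} (≤ᵇ⇒≤ 4 16 tt) ⟩
    16 * q                   ≡⟨ ^-distribˡ-+-* 2 4 (8 * i + 3) ⟨
    2 ^ (4 + (8 * i + 3))    ≤⟨ pow-mono (subst (4 + (8 * i + 3) ≤_) (exponent i) (+-monoˡ-≤ (8 * i + 3) (≤ᵇ⇒≤ 4 9 tt))) ⟩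
    2 ^ (8 * i + 12)         ∎
    where
    open ≤-Reasoning hiding (start)
    q = 2 ^ (8 * i + 3)
    instance _ = >-nonZero (pow-pos (8 * i + 3))
    exponent : ∀ i → 9 + (8 * i + 3) ≡ 8 * i + 12
    exponent = solve-∀

  G≥5 : ∀ j → 5 ≤ G j
  G≥5 j = ≤-trans (≤ᵇ⇒≤ 5 4095 tt) (G≥4095 j)

  G≥2 : ∀ j → 2 ≤ G j
  G≥2 j = ≤-trans (≤ᵇ⇒≤ 2 5 tt) (G≥5 j)

  G≥1 : ∀ j → 1 ≤ G j
  G≥1 j = ≤-trans (≤ᵇ⇒≤ 1 2 tt) (G≥2 j)

  -- When tile j is long compared to i (i < M j), the private point X i and the tile boundary
  -- A (j + 1) are small compared to the gaps around block G j.
  longTile-bound : ∀ i j → i < M j → X i + A (suc j) ≤ 2 ^ G j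
  longTile-bound i j i<Mj = *-cancelˡ-≤ 4 (begin
    4 * (X i + A (suc j))                ≤⟨ *-monoʳ-≤ 4 (+-monoʳ-≤ (X i) (A-suc≤2L j)) ⟩
    4 * (X i + 2 * L j)                  ≡⟨ trans (distribute (X i) (L j)) (cong (λ l → 4 * X i + 2 * (4 * l)) (L≡suc-G j)) ⟩
    4 * X i + 2 * (4 * suc (G j))        ≤⟨ +-mono-≤ 4X≤ (*-monoʳ-≤ 2 (linear≤pow (G j) (G≥5 j))) ⟩
    2 ^ G j + 2 * 2 ^ G j                ≤⟨ *-monoˡ-≤ (2 ^ G j) {3} {4} (≤ᵇ⇒≤ 3 4 tt) ⟩
    4 * 2 ^ G j                          ∎)
    where
    open ≤-Reasoning hiding (start)
    distribute : ∀ x l → 4 * (x + 2 * l) ≡ 4 * x + 2 * (4 * l)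
    distribute = solve-∀
    exponent : 8 * i + 7 ≤ G j
    exponent = s≤s⁻¹ (subst₂ _≤_ (scaled i) (L≡suc-G j) (*-monoʳ-≤ 8 i<Mj))
      where
      scaled : ∀ i → 8 * suc i ≡ suc (8 * i + 7)
      scaled = solve-∀
    4X≤ : 4 * X i ≤ 2 ^ G j
    4X≤ = begin
      4 * (3 * q)              ≤⟨ subst (_≤ 16 * q) (*-assoc 4 3 q) (*-monoˡ-≤ q {12} {16} (≤ᵇ⇒≤ 12 16 tt)) ⟩
      16 * q                   ≡⟨ trans (cong (2 ^_) (sym (exponent′ i))) (^-distribˡ-+-* 2 4 (8 * i + 3)) ⟨
      2 ^ (8 * i + 7)          ≤⟨ pow-mono exponent ⟩
      2 ^ G j                  ∎
      where
      q = 2 ^ (8 * i + 3)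
      exponent′ : ∀ i → 4 + (8 * i + 3) ≡ 8 * i + 7
      exponent′ = solve-∀

  -- When tile j is short compared to i (M j ≤ i), its block start and tile boundary are
  -- smaller than 2^(8i+3), the margin of X i inside its gap.
  shortTile-bound : ∀ i j → M j ≤ i → S j + A (suc j) < 2 ^ (8 * i + 3)
  shortTile-bound i j Mj≤i = begin-strict
    S j + A (suc j)                     ≤⟨ +-monoʳ-≤ (S j) (A-suc≤2L j) ⟩
    S j + 2 * L j                       ≡⟨ cong₂ (λ s l → s + 2 * l) (start≡ g) (L≡suc-G j) ⟩
    tri g + 2 ^ suc g + 2 * suc g       ≡⟨ regroup (tri g) (2 ^ suc g) (2 * suc g) ⟩
    (tri g + 2 * suc g) + 2 ^ suc g     <⟨ +-monoˡ-< (2 ^ suc g) (≤-<-trans (tri≤pow g (G≥5 j)) (^-monoʳ-< 2 (s≤s (s≤s z≤n)) (n<1+n g))) ⟩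
    2 ^ suc g + 2 ^ suc g               ≡⟨ pow-suc (suc g) ⟨
    2 ^ suc (suc g)                     ≤⟨ pow-mono exponent ⟩
    2 ^ (8 * i + 3)                     ∎
    where
    open ≤-Reasoning hiding (start)
    g = G j
    regroup : ∀ t p l → t + p + l ≡ (t + l) + p
    regroup = solve-∀
    exponent : suc (suc g) ≤ 8 * i + 3
    exponent = ≤-trans (s≤s (subst (_≤ 8 * i) (L≡suc-G j) (*-monoʳ-≤ 8 Mj≤i)))
                       (subst (_≤ 8 * i + 3) (+-comm (8 * i) 1) (+-monoʳ-≤ (8 * i) (≤ᵇ⇒≤ 1 3 tt)))

  margin≤X : ∀ i → 2 ^ (8 * i + 3) ≤ X i
  margin≤X i = m≤n*m (2 ^ (8 * i + 3)) 3

  A≤S : ∀ j → A j ≤ S j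
  A≤S j = begin
    A j                  ≤⟨ A≤L j ⟩
    L j                  ≡⟨ L≡suc-G j ⟩
    suc (G j)            ≤⟨ n<2^n (G j) ⟩
    2 ^ G j              ≤⟨ pow-mono (n≤1+n (G j)) ⟩
    2 ^ suc (G j)        ≤⟨ m≤n+m (2 ^ suc (G j)) (tri (G j)) ⟩
    tri (G j) + 2 ^ suc (G j) ≡⟨ start≡ (G j) ⟨
    S j                  ∎
    where open ≤-Reasoning hiding (start)

module PrivatePoints where

  open GapsOfW
  open TileParameters

  open import Data.Nat
  open import Data.Nat.Properties
  import Data.Integer as ℤ
  open import Data.Sum using (_⊎_; inj₁; inj₂)
  open import Data.Unit using (tt)
  open import Relation.Nullary using (¬_; contradiction)
  open import Relation.Binary using (tri<; tri≈; tri>)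
  open import Relation.Binary.PropositionalEquality

  compareTiles : ∀ i j → i < M j ⊎ M j ≤ i
  compareTiles i j = <-≤-connex i (M j)

  module _ {i j : ℕ} where

    gapIndex≥5 : M j ≤ i → 5 ≤ 8 * i + 3
    gapIndex≥5 Mj≤i = ≤-trans (≤ᵇ⇒≤ 5 11 tt) (+-monoˡ-≤ 3 (*-monoʳ-≤ 8 (≤-trans (s≤s z≤n) (≤-trans (M≥512 j) Mj≤i))))

    S<margin : M j ≤ i → S j < 2 ^ (8 * i + 3)
    S<margin Mj≤i = ≤-<-trans (m≤m+n (S j) (A (suc j))) (shortTile-bound i j Mj≤i)

    X≤2^G : i < M j → X i ≤ 2 ^ G j
    X≤2^G i<Mj = ≤-trans (m≤m+n (X i) (A (suc j))) (longTile-bound i j i<Mj)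

    A-suc≤2^G : i < M j → A (suc j) ≤ 2 ^ G j
    A-suc≤2^G i<Mj = ≤-trans (m≤n+m (A (suc j)) (X i)) (longTile-bound i j i<Mj)

    boundary<X : j < i → A (suc j) < X i
    boundary<X j<i = ≤-<-trans (A-mono j<i) (A<X i)

    X<boundary : i < j → X i < A j
    X<boundary i<j = <-≤-trans (X<A-suc i) (A-mono i<j)

    blockEnd<boundary : ∀ x → x ≤ A j → x + G j < A (suc j)
    blockEnd<boundary x x≤Aj = subst (x + G j <_) (sym (A-suc j)) (+-mono-≤-< x≤Aj (n<1+n (G j)))

    -- A translate of W other than the tile-i one reaches ± X i only if some n ∈ ℕ satisfies one
    -- of the four equations below; in each case n lies within 2^(G j) of block G j but outside
    -- it (tile j long), or in the gap around X i (tile j short), or the equation is impossible.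

    -- n + (A j - S j) = X i with j ≠ i.
    avoidPlusPlus : ∀ {n} → j ≢ i → n + A j ≡ S j + X i → ¬ W (ℤ.+ n)
    avoidPlusPlus {n} j≢i eq with compareTiles i j
    ... | inj₂ Mj≤i = nearMiddleOfGap (8 * i + 3) (gapIndex≥5 Mj≤i) n (A j) (S j)
                        (trans eq (+-comm (S j) (X i))) (A≤S j) (S<margin Mj≤i)
    ... | inj₁ i<Mj with <-cmp j i
    ...   | tri< j<i _ _ = rightOfBlock (G j) (G≥1 j) n (A j) (X i) eq
                             (<-trans (blockEnd<boundary (A j) ≤-refl) (boundary<X j<i)) (≤-trans (X≤2^G i<Mj) (m≤n+m (2 ^ G j) (A j)))
    ...   | tri≈ _ j≡i _ = contradiction j≡i j≢i
    ...   | tri> _ _ i<j = leftOfBlock (G j) (G≥2 j) n (A j) (X i) eq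
                             (X<boundary i<j) (≤-trans (≤-trans (A-mono (n≤1+n j)) (A-suc≤2^G i<Mj)) (m≤n+m (2 ^ G j) (X i)))

    -- n - (A (j + 1) + S j) = X i.
    avoidPlusMinus : ∀ {n} → n ≡ S j + (X i + A (suc j)) → ¬ W (ℤ.+ n)
    avoidPlusMinus {n} eq with compareTiles i j
    ... | inj₂ Mj≤i = nearMiddleOfGap (8 * i + 3) (gapIndex≥5 Mj≤i) n 0 (A (suc j) + S j)
                        (trans (+-identityʳ n) (trans eq (swap (S j) (X i) (A (suc j))))) z≤n
                        (subst (_< 2 ^ (8 * i + 3)) (+-comm (S j) (A (suc j))) (shortTile-bound i j Mj≤i))
      where
      swap : ∀ s x a → s + (x + a) ≡ x + (a + s)
      swap s x a = trans (+-comm s (x + a)) (+-assoc x a s)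
    ... | inj₁ i<Mj = rightOfBlock (G j) (G≥1 j) n 0 (X i + A (suc j)) (trans (+-identityʳ n) eq)
                        (≤-trans (blockEnd<boundary 0 z≤n) (m≤n+m (A (suc j)) (X i))) (longTile-bound i j i<Mj)

    -- n + (A j - S j) = - X i.
    avoidMinusPlus : ∀ {n} → n + (A j + X i) ≡ S j → ¬ W (ℤ.+ n)
    avoidMinusPlus {n} eq with compareTiles i j
    ... | inj₂ Mj≤i = λ _ → <-irrefl refl (<-≤-trans (S<margin Mj≤i)
                        (≤-trans (margin≤X i) (subst (X i ≤_) eq (≤-trans (m≤n+m (X i) (A j)) (m≤n+m (A j + X i) n)))))
    ... | inj₁ i<Mj = leftOfBlock (G j) (G≥2 j) n (A j + X i) 0 (trans eq (sym (+-identityʳ (S j))))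
                        (<-≤-trans (≤-<-trans z≤n (A<X i)) (m≤n+m (X i) (A j)))
                        (subst (_≤ 2 ^ G j) (+-comm (X i) (A j))
                          (≤-trans (+-monoʳ-≤ (X i) (A-mono (n≤1+n j))) (longTile-bound i j i<Mj)))

    -- n - (A (j + 1) + S j) = - X i with j ≠ i.
    avoidMinusMinus : ∀ {n} → j ≢ i → n + X i ≡ S j + A (suc j) → ¬ W (ℤ.+ n)
    avoidMinusMinus {n} j≢i eq with compareTiles i j
    ... | inj₂ Mj≤i = λ _ → <-irrefl refl (<-≤-trans (shortTile-bound i j Mj≤i)
                        (≤-trans (margin≤X i) (subst (X i ≤_) eq (m≤n+m (X i) n))))
    ... | inj₁ i<Mj with <-cmp j i
    ...   | tri< j<i _ _ = leftOfBlock (G j) (G≥2 j) n (X i) (A (suc j)) eq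
                             (boundary<X j<i) (≤-trans (X≤2^G i<Mj) (m≤n+m (2 ^ G j) (A (suc j))))
    ...   | tri≈ _ j≡i _ = contradiction j≡i j≢i
    ...   | tri> _ _ i<j = rightOfBlock (G j) (G≥1 j) n (X i) (A (suc j)) eq
                             (blockEnd<boundary (X i) (<⇒≤ (X<boundary i<j))) (≤-trans (A-suc≤2^G i<Mj) (m≤n+m (2 ^ G j) (X i)))

module MinimalComplement where

  open TileParameters
  open PrivatePoints

  open import Data.Nat as ℕ using (ℕ; suc; s≤s; z≤n)
  import Data.Nat.Properties as ℕP
  open import Data.Integer hiding (suc)
  open import Data.Integer.Properties
  open import Data.Integer.Tactic.RingSolver using (solve-∀)
  open import Data.Product using (Σ; _,_)
  open import Data.Sum using (inj₁; inj₂)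
  open import Relation.Nullary using (¬_)
  open import Relation.Binary.PropositionalEquality

  open Tilings.Tiling start G A refl A-suc G≥1

  -- Clearing the subtractions in w + c = ± x, for w = + n and c a tile translate, gives the
  -- equations in ℕ used by the private-point lemmas.
  plus-plus : ∀ {n a s x} → + n + (+ a - + s) ≡ + x → n ℕ.+ a ≡ s ℕ.+ x
  plus-plus {n} {a} {s} {x} eq = +-injective (begin
    + (n ℕ.+ a)                 ≡⟨ pos-+ n a ⟩
    + n + + a                   ≡⟨ regroup (+ n) (+ a) (+ s) ⟩
    + n + (+ a - + s) + + s     ≡⟨ cong (_+ + s) eq ⟩
    + x + + s                   ≡⟨ +-comm (+ x) (+ s) ⟩
    + s + + x                   ≡⟨ pos-+ s x ⟨
    + (s ℕ.+ x)                 ∎)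
    where
    open ≡-Reasoning
    regroup : ∀ n a s → n + a ≡ n + (a - s) + s
    regroup = solve-∀

  plus-minus : ∀ {n b s x} → + n + - + (b ℕ.+ s) ≡ + x → n ≡ s ℕ.+ (x ℕ.+ b)
  plus-minus {n} {b} {s} {x} eq = +-injective (begin
    + n                                 ≡⟨ regroup (+ n) (+ (b ℕ.+ s)) ⟩
    + n + - + (b ℕ.+ s) + + (b ℕ.+ s)   ≡⟨ cong₂ _+_ eq (pos-+ b s) ⟩
    + x + (+ b + + s)                   ≡⟨ regroup′ (+ x) (+ b) (+ s) ⟩
    + s + (+ x + + b)                   ≡⟨ trans (cong (_+_ (+ s)) (pos-+ x b)) (pos-+ s (x ℕ.+ b)) ⟨
    + (s ℕ.+ (x ℕ.+ b))                 ∎)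
    where
    open ≡-Reasoning
    regroup : ∀ n c → n ≡ n + - c + c
    regroup = solve-∀
    regroup′ : ∀ x b s → x + (b + s) ≡ s + (x + b)
    regroup′ = solve-∀

  minus-plus : ∀ {n a s x} → + n + (+ a - + s) ≡ - + x → n ℕ.+ (a ℕ.+ x) ≡ s
  minus-plus {n} {a} {s} {x} eq = +-injective (begin
    + (n ℕ.+ (a ℕ.+ x))           ≡⟨ trans (pos-+ n (a ℕ.+ x)) (cong (_+_ (+ n)) (pos-+ a x)) ⟩
    + n + (+ a + + x)             ≡⟨ regroup (+ n) (+ a) (+ s) (+ x) ⟩
    + n + (+ a - + s) + + s + + x ≡⟨ cong (λ y → y + + s + + x) eq ⟩
    - + x + + s + + x             ≡⟨ cancel (+ x) (+ s) ⟩
    + s                           ∎)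
    where
    open ≡-Reasoning
    regroup : ∀ n a s x → n + (a + x) ≡ n + (a - s) + s + x
    regroup = solve-∀
    cancel : ∀ x s → - x + s + x ≡ s
    cancel = solve-∀

  minus-minus : ∀ {n b s x} → + n + - + (b ℕ.+ s) ≡ - + x → n ℕ.+ x ≡ s ℕ.+ b
  minus-minus {n} {b} {s} {x} eq = +-injective (begin
    + (n ℕ.+ x)                                  ≡⟨ pos-+ n x ⟩
    + n + + x                                    ≡⟨ regroup (+ n) (+ x) (+ (b ℕ.+ s)) ⟩
    + n + - + (b ℕ.+ s) + + (b ℕ.+ s) + + x      ≡⟨ cong (λ y → y + + (b ℕ.+ s) + + x) eq ⟩
    - + x + + (b ℕ.+ s) + + x                    ≡⟨ cancel (+ x) (+ (b ℕ.+ s)) ⟩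
    + (b ℕ.+ s)                                  ≡⟨ cong +_ (ℕP.+-comm b s) ⟩
    + (s ℕ.+ b)                                  ∎)
    where
    open ≡-Reasoning
    regroup : ∀ n x c → n + x ≡ n + - c + c + x
    regroup = solve-∀
    cancel : ∀ x c → - x + c + x ≡ c
    cancel = solve-∀

  -- X i is reached only through the tile-i translate shift⁺ i, and - X i only through shift⁻ i
  -- (negative integers are not in W, so w = + n).
  private⁺ : ∀ i c w → Shifts c → c ≢ shift⁺ i → W w → w + c ≢ + X i
  private⁺ i c -[1+ n ] _ _ (_ , _ , () , _)
  private⁺ i c (+ n) (j , inj₁ refl) c≢ Ww eq =
    avoidPlusPlus {i} {j} (λ j≡i → c≢ (cong shift⁺ j≡i)) (plus-plus {n} {A j} {S j} eq) Ww
  private⁺ i c (+ n) (j , inj₂ refl) _ Ww eq =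
    avoidPlusMinus {i} {j} (plus-minus {n} {A (suc j)} {S j} eq) Ww

  private⁻ : ∀ i c w → Shifts c → c ≢ shift⁻ i → W w → w + c ≢ - + X i
  private⁻ i c -[1+ n ] _ _ (_ , _ , () , _)
  private⁻ i c (+ n) (j , inj₁ refl) _ Ww eq =
    avoidMinusPlus {i} {j} (minus-plus {n} {A j} {S j} eq) Ww
  private⁻ i c (+ n) (j , inj₂ refl) c≢ Ww eq =
    avoidMinusMinus {i} {j} (λ j≡i → c≢ (cong shift⁻ j≡i)) (minus-minus {n} {A (suc j)} {S j} eq) Ww

  minimalComplement : IsMinimalComplement W Shifts
  minimalComplement = ((+ 4 , W∋4) , (shift⁺ 0 , 0 , inj₁ refl) , covers) , minimal
    where
    W∋4 : W (+ 4)
    W∋4 = 1 , s≤s z≤n , +≤+ ℕP.≤-refl , +≤+ (ℕP.n≤1+n 4)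
    minimal : ∀ c → Shifts c → ¬ IsComplement W (Remove Shifts c)
    minimal c (i , inj₁ refl) (_ , _ , covers′) with covers′ (+ X i)
    ... | w , c′ , Ww , (Sc′ , c′≢c) , eq = private⁺ i c′ w Sc′ c′≢c Ww eq
    minimal c (i , inj₂ refl) (_ , _ , covers′) with covers′ (- + X i)
    ... | w , c′ , Ww , (Sc′ , c′≢c) , eq = private⁻ i c′ w Sc′ c′≢c Ww eq

open import Data.Integer using (ℤ; _<_)
open import Data.Product using (Σ; _×_; _,_)
open import Relation.Nullary using (¬_)
open BlockUnions using (removeMiddle; noMinimalAsymptoticComplement; Blocks≥0)

lemma4p4 : (Σ ℤSet λ C → IsMinimalComplement W C)
    × (∀ (C : ℤSet) → IsAsymptoticComplement W C → ∀ a b c → C a → C b → C c → a < b → b < c → IsAsymptoticComplement W (Remove C b))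
    × ¬ (Σ ℤSet λ C → IsMinimalAsymptoticComplement W C)
lemma4p4 =
  (_ , MinimalComplement.minimalComplement) ,
  removeMiddle start ,
  noMinimalAsymptoticComplement W (Blocks≥0 start) (removeMiddle start)
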